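{- Let $n, k, \ell, t$ be positive integers with $1 \leq t \leq \ell-1$, and let $\mathcal{P}$ be a $t$-intersecting family of $(k,\ell)$-subpartitions of $[n]$. Assume that there is no $k$-set that occurs as a class in every $(k,\ell)$-subpartition in $\mathcal{P}$. Then $$|\mathcal{P}| \leq (\ell-t+1) \binom{\ell}{t}\, U(n-(t+1)k,\ell-(t+1),k).$$
   Context: Let $[n]=\{1,\dots,n\}$. A $(k,\ell)$-subpartition of $[n]$ is a set $P=\{P_1,\dots,P_\ell\}$ of $\ell$ pairwise disjoint $k$-subsets of $[n]$ (called classes). Two $(k,\ell)$-subpartitions are $t$-intersecting if they have at least $t$ classes in common; a family is $t$-intersecting if every two of its members are $t$-intersecting. For integers $m$, $j\ge 0$, $k$, define $U(m,j,k) = \frac{1}{j!}\prod_{i=0}^{j-1}\binom{m-ik}{k}$ (the number of $(k,j)$-subpartitions of an $m$-set; an empty product equals $1$, so $U(m,0,k)=1$). -}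

module Defs where

open import Data.Nat using (ℕ; zero; suc; _+_; _*_; _∸_; _/_; _≤_)
open import Data.Nat.Properties using (_!≢0)
open import Data.Nat.Combinatorics using (_C_)
open import Data.Nat.Base using (_!)
open import Data.Fin.Subset using (Subset; ∣_∣; _∩_; Empty)
open import Data.List using (List; length)
open import Data.List.Relation.Unary.All using (All)
open import Data.List.Relation.Unary.AllPairs using (AllPairs)
open import Data.List.Relation.Unary.Unique.Propositional using (Unique)
open import Data.List.Membership.Propositional using (_∈_)
open import Data.List.Relation.Binary.Subset.Propositional using (_⊆_)
open import Data.Product using (Σ; _×_)
open import Relation.Nullary using (¬_)
open import Relation.Binary.PropositionalEquality using (_≡_)

-- A (k,ℓ)-subpartition of [n] is represented by a duplicate-free list of its
-- classes: ℓ pairwise distinct, pairwise disjoint k-subsets of [n].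
-- (The order of the list is irrelevant; see SameClasses below.)
record IsSubpartition (n k ℓ : ℕ) (P : List (Subset n)) : Set where
  field
    numClasses : length P ≡ ℓ
    distinct   : Unique P
    classSize  : All (λ A → ∣ A ∣ ≡ k) P
    disjoint   : AllPairs (λ A B → Empty (A ∩ B)) P

SameClasses : ∀ {n} → List (Subset n) → List (Subset n) → Set
SameClasses P Q = (P ⊆ Q) × (Q ⊆ P)

TIntersecting : ∀ {n} → ℕ → List (Subset n) → List (Subset n) → Set
TIntersecting {n} t P Q =
  Σ (List (Subset n)) λ C → Unique C × length C ≡ t × C ⊆ P × C ⊆ Q

-- A family of (k,ℓ)-subpartitions of [n], represented by a list of
-- subpartitions no two of which are the same set of classes
-- (so |family| = length of the list).
record IsFamily (n k ℓ : ℕ) (F : List (List (Subset n))) : Set where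
  field
    members  : All (IsSubpartition n k ℓ) F
    distinct : AllPairs (λ P Q → ¬ SameClasses P Q) F

IsTIntersectingFamily : ∀ {n} → ℕ → List (List (Subset n)) → Set
IsTIntersectingFamily t F = All (λ P → All (λ Q → TIntersecting t P Q) F) F

prodBinom : ℕ → ℕ → ℕ → ℕ
prodBinom m zero    k = 1
prodBinom m (suc j) k = (m C k) * prodBinom (m ∸ k) j k

U : ℕ → ℕ → ℕ → ℕ
U m j k = (prodBinom m j k / (j !)) {{j !≢0}}

-- Fix a member P of the family.  For a set T of t classes of P with first class A, pick a member R
-- not containing A (one exists since no class is common to all members) and let W_T be the first
-- ℓ − t + 1 classes of R outside T.  Every member Q shares t classes with P, so it contains such a T,
-- and it contains a class of W_T: otherwise the t classes it shares with R would lie among the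
-- a ≤ t − 1 classes of R inside T and the (ℓ − a) − (ℓ − t + 1) = t − 1 − a classes of R outside
-- T ∪ W_T.  So every member contains one of at most (ℓ − t + 1) C(ℓ,t) sets T ∪ {B} of t + 1 classes,
-- and deleting these classes from the members containing them leaves a family of
-- (k, ℓ − t − 1)-subpartitions of n − (t + 1)k points.  Such a family of (k, j)-subpartitions of an
-- m-set has at most U(m, j, k) members: double counting (class, member) incidences gives
-- j · |family| ≤ Σ_A |members containing A| over the C(m, k) possible classes A, and each term is
-- bounded by induction on j after deleting A.

module Submission where

open import Defs
open import Data.Nat using (ℕ; zero; suc; _+_; _*_; _∸_; _⊓_; _≤_; _<_; z≤n; s≤s; _!; NonZero)
open import Data.Nat.Properties
open import Data.Nat.DivMod using (_/_; m*n/n≡m; /-monoˡ-≤)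
open import Data.Nat.Combinatorics using (_C_; k>n⇒nCk≡0; nCk+nC[k+1]≡[n+1]C[k+1])
open import Data.Nat.ListAction using (sum)
open import Algebra.Properties.CommutativeSemigroup +-commutativeSemigroup
  using () renaming (interchange to +-interchange)
open import Data.Bool using (true; false; if_then_else_)
import Data.Bool as Bool
open import Data.Vec using ([]; _∷_; here)
open import Data.Vec.Properties using (≡-dec)
open import Data.Fin.Subset using (Subset; ∣_∣; _∩_; _─_; Empty; inside; outside; ⊤)
  renaming (_⊆_ to _⊆ₛ_)
open import Data.Fin.Subset.Properties
  using (drop-∷-⊆; out⊆; in⊆in; ⊆⊤; ∣⊤∣≡n; x∈p∩q⁺; x∈p∧x∉q⇒x∈p─q; ∩-comm)
open import Data.List
  using (List; []; _∷_; [_]; length; filter; map; take; drop; _++_; concatMap)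
open import Data.List.Properties
  using (length-map; length-++; length-take; length-drop; take++drop≡id; filter-notAll; filter-some)
open import Data.List.Relation.Unary.All as All using (All; []; _∷_; all?)
import Data.List.Relation.Unary.All.Properties as All
open import Data.List.Relation.Unary.Any as Any using (Any; here; there; any?)
import Data.List.Relation.Unary.Any.Properties as Any
open import Data.List.Relation.Unary.AllPairs as AllPairs using (AllPairs; []; _∷_)
import Data.List.Relation.Unary.AllPairs.Properties as AllPairs
open import Data.List.Relation.Unary.Unique.Propositional using (Unique)
import Data.List.Relation.Unary.Unique.Propositional.Properties as Unique
open import Data.List.Membership.Propositional using (_∈_; _∉_; lose; find)
open import Data.List.Membership.Propositional.Properties
  using (∈-filter⁺; ∈-filter⁻; ∈-map⁺; ∈-map⁻; ∈-++⁺ˡ; ∈-++⁺ʳ; ∈-++⁻)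
open import Data.List.Relation.Binary.Subset.Propositional using (_⊆_)
open import Data.List.Relation.Binary.Sublist.Propositional
  using ([]; _∷_; _∷ʳ_; minimum; ⊆-trans) renaming (_⊆_ to _⊑_)
open import Data.List.Relation.Binary.Sublist.Propositional.Properties
  using (All-resp-⊆; take-⊆; filter-⊆)
open import Data.Product using (Σ; _×_; _,_)
open import Data.Sum using (inj₁; inj₂)
open import Data.Empty using (⊥-elim)
open import Relation.Nullary using (¬_; yes; no; ¬?; does; contradiction)
open import Relation.Unary using (Pred; Decidable)
open import Relation.Binary.Core using (REL; Rel)
open import Relation.Binary.Definitions using (DecidableEquality; Symmetric)
  renaming (Decidable to Decidable₂)
open import Relation.Binary.PropositionalEquality
  using (_≡_; _≢_; refl; sym; trans; cong; cong₂; subst; subst₂; module ≡-Reasoning)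

a+[d∸[a+d∸t+1]]<t : ∀ {a d t} → a < t → t ≤ a + d → a + (d ∸ (a + d ∸ t + 1)) < t
a+[d∸[a+d∸t+1]]<t {a} {d} {suc t} a<t t≤a+d = begin-strict
  a + (d ∸ (e + 1))             ≡⟨ +-∸-assoc a e+1≤d ⟨
  a + d ∸ (e + 1)               ≡⟨ ∸-+-assoc (a + d) e 1 ⟨
  a + d ∸ (a + d ∸ suc t) ∸ 1   ≡⟨ cong (_∸ 1) (m∸[m∸n]≡n t≤a+d) ⟩
  t                             <⟨ ≤-refl ⟩
  suc t                         ∎
  where
  open ≤-Reasoning
  e = a + d ∸ suc t
  e<d : e < d
  e<d = +-cancelˡ-< (suc t) e d (begin-strict
    suc t + e ≡⟨ m+[n∸m]≡n t≤a+d ⟩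
    a + d     <⟨ +-monoˡ-< d a<t ⟩
    suc t + d ∎)
  e+1≤d : e + 1 ≤ d
  e+1≤d = ≤-trans (≤-reflexive (+-comm e 1)) e<d

m*n≤o⇒n≤o/m : ∀ m n o .{{_ : NonZero m}} → m * n ≤ o → n ≤ o / m
m*n≤o⇒n≤o/m m n o m*n≤o = begin
  n         ≡⟨ m*n/n≡m n m ⟨
  n * m / m ≤⟨ /-monoˡ-≤ m (≤-trans (≤-reflexive (*-comm n m)) m*n≤o) ⟩
  o / m     ∎
  where open ≤-Reasoning

module _ {a r} {A : Set a} {R : Rel A r} where

  AllPairs-lookup : Symmetric R → ∀ {x y xs} → AllPairs R xs → x ∈ xs → y ∈ xs → x ≢ y → R x y
  AllPairs-lookup R-sym (_ ∷ _)   (here refl) (here refl) x≢y = ⊥-elim (x≢y refl)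
  AllPairs-lookup R-sym (Rx ∷ _)  (here refl) (there y∈)  _   = All.lookup Rx y∈
  AllPairs-lookup R-sym (Ry ∷ _)  (there x∈)  (here refl) _   = R-sym (All.lookup Ry x∈)
  AllPairs-lookup R-sym (_ ∷ Rxs) (there x∈)  (there y∈)  x≢y = AllPairs-lookup R-sym Rxs x∈ y∈ x≢y

module _ {a p r} {A : Set a} {P : Pred A p} {R : Rel A r} where

  AllPairs-discharge : ∀ {xs} → All P xs → AllPairs (λ x y → P x → P y → R x y) xs → AllPairs R xs
  AllPairs-discharge []         []          = []
  AllPairs-discharge (px ∷ pxs) (Rx ∷ Rxs) =
    All.zipWith (λ (py , Rxy) → Rxy px py) (pxs , Rx) ∷ AllPairs-discharge pxs Rxs

module _ {a p} {A : Set a} {P : Pred A p} (P? : Decidable P) where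

  firstFailing : A → List A → A
  firstFailing d []       = d
  firstFailing d (x ∷ xs) with P? x
  ... | yes _ = firstFailing d xs
  ... | no  _ = x

  firstFailing-spec : ∀ {d} xs → ¬ All P xs → firstFailing d xs ∈ xs × ¬ P (firstFailing d xs)
  firstFailing-spec []       ¬all = ⊥-elim (¬all [])
  firstFailing-spec (x ∷ xs) ¬all with P? x
  ... | yes px = let (y∈xs , ¬py) = firstFailing-spec xs (λ all → ¬all (px ∷ all))
                 in there y∈xs , ¬py
  ... | no ¬px = here refl , ¬px

  length-filter+length-filter-¬ : ∀ xs →
    length (filter P? xs) + length (filter (λ x → ¬? (P? x)) xs) ≡ length xs
  length-filter+length-filter-¬ []       = refl
  length-filter+length-filter-¬ (x ∷ xs) with P? x
  ... | yes _ = cong suc (length-filter+length-filter-¬ xs)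
  ... | no  _ = trans (+-suc _ _) (cong suc (length-filter+length-filter-¬ xs))

  length-filter-∷ : ∀ x xs →
    length (filter P? (x ∷ xs)) ≡ (if does (P? x) then 1 else 0) + length (filter P? xs)
  length-filter-∷ x xs with does (P? x)
  ... | true  = refl
  ... | false = refl

  sum-map-if-does : ∀ xs → sum (map (λ x → if does (P? x) then 1 else 0) xs) ≡ length (filter P? xs)
  sum-map-if-does []       = refl
  sum-map-if-does (x ∷ xs) = trans (cong (_ +_) (sum-map-if-does xs)) (sym (length-filter-∷ x xs))

module _ {a} {A : Set a} where

  combinations : ℕ → List A → List (List A)
  combinations zero    xs       = [ [] ]
  combinations (suc k) []       = []
  combinations (suc k) (x ∷ xs) = map (x ∷_) (combinations k xs) ++ combinations (suc k) xs

  length-combinations : ∀ k (xs : List A) → length (combinations k xs) ≡ length xs C k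
  length-combinations zero    xs       = refl
  length-combinations (suc k) []       = sym (k>n⇒nCk≡0 {0} {suc k} (s≤s z≤n))
  length-combinations (suc k) (x ∷ xs) = begin
    length (map (x ∷_) (combinations k xs) ++ combinations (suc k) xs)
      ≡⟨ length-++ (map (x ∷_) (combinations k xs)) ⟩
    length (map (x ∷_) (combinations k xs)) + length (combinations (suc k) xs)
      ≡⟨ cong₂ _+_ (trans (length-map (x ∷_) (combinations k xs)) (length-combinations k xs))
                   (length-combinations (suc k) xs) ⟩
    length xs C k + length xs C suc k
      ≡⟨ nCk+nC[k+1]≡[n+1]C[k+1] (length xs) k ⟩
    suc (length xs) C suc k ∎
    where open ≡-Reasoning

  ∈-combinations⁺ : ∀ {ys xs : List A} → ys ⊑ xs → ys ∈ combinations (length ys) xs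
  ∈-combinations⁺ {[]}     {[]}     []         = here refl
  ∈-combinations⁺ {[]}     {_ ∷ _}  (_ ∷ʳ _)   = here refl
  ∈-combinations⁺ {_ ∷ ys} {x ∷ xs} (_ ∷ʳ σ)   =
    ∈-++⁺ʳ (map (x ∷_) (combinations (length ys) xs)) (∈-combinations⁺ σ)
  ∈-combinations⁺ {_ ∷ ys} {x ∷ xs} (refl ∷ σ) = ∈-++⁺ˡ (∈-map⁺ (x ∷_) (∈-combinations⁺ σ))

  ∈-combinations⁻ : ∀ k (xs : List A) {ys} → ys ∈ combinations k xs → ys ⊑ xs × length ys ≡ k
  ∈-combinations⁻ zero    xs (here refl) = minimum xs , refl
  ∈-combinations⁻ (suc k) (x ∷ xs) ys∈ with ∈-++⁻ (map (x ∷_) (combinations k xs)) ys∈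
  ... | inj₂ ys∈′ with ∈-combinations⁻ (suc k) xs ys∈′
  ...   | σ , len = x ∷ʳ σ , len
  ∈-combinations⁻ (suc k) (x ∷ xs) ys∈ | inj₁ ys∈′ with ∈-map⁻ (x ∷_) ys∈′
  ... | zs , zs∈ , refl with ∈-combinations⁻ k xs zs∈
  ...   | σ , len = refl ∷ σ , cong suc len

  Unique-⊑ : ∀ {ys xs : List A} → ys ⊑ xs → Unique xs → Unique ys
  Unique-⊑ []         u          = u
  Unique-⊑ (_ ∷ʳ σ)   (_ ∷ u)    = Unique-⊑ σ u
  Unique-⊑ (refl ∷ σ) (x∉ ∷ u)   = All-resp-⊆ σ x∉ ∷ Unique-⊑ σ u

-- Double counting

module _ {a} {A : Set a} where

  sum-map-≤ : ∀ {f : A → ℕ} {m} {xs} → All (λ x → f x ≤ m) xs → sum (map f xs) ≤ length xs * m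
  sum-map-≤ []           = z≤n
  sum-map-≤ (fx≤m ∷ f≤m) = +-mono-≤ fx≤m (sum-map-≤ f≤m)

  sum-map-≥ : ∀ {f : A → ℕ} {m} {xs} → All (λ x → m ≤ f x) xs → length xs * m ≤ sum (map f xs)
  sum-map-≥ []           = z≤n
  sum-map-≥ (m≤fx ∷ m≤f) = +-mono-≤ m≤fx (sum-map-≥ m≤f)

  *-sum-map : ∀ m (f : A → ℕ) xs → m * sum (map f xs) ≡ sum (map (λ x → m * f x) xs)
  *-sum-map m f []       = *-zeroʳ m
  *-sum-map m f (x ∷ xs) = trans (*-distribˡ-+ m (f x) _) (cong (m * f x +_) (*-sum-map m f xs))

  sum-map-+ : ∀ (f g : A → ℕ) xs → sum (map (λ x → f x + g x) xs) ≡ sum (map f xs) + sum (map g xs)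
  sum-map-+ f g []       = refl
  sum-map-+ f g (x ∷ xs) =
    trans (cong (f x + g x +_) (sum-map-+ f g xs)) (+-interchange (f x) (g x) _ _)

  sum-map-cong : ∀ {f g : A → ℕ} xs → (∀ x → f x ≡ g x) → sum (map f xs) ≡ sum (map g xs)
  sum-map-cong []       f≗g = refl
  sum-map-cong (x ∷ xs) f≗g = cong₂ _+_ (f≗g x) (sum-map-cong xs f≗g)

  sum-map-0 : ∀ (xs : List A) → sum (map (λ _ → 0) xs) ≡ 0
  sum-map-0 []       = refl
  sum-map-0 (x ∷ xs) = sum-map-0 xs

module _ {a b} {A : Set a} {B : Set b} where

  length-concatMap-≤ : ∀ (f : A → List B) {m} xs → All (λ x → length (f x) ≤ m) xs →
                       length (concatMap f xs) ≤ length xs * m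
  length-concatMap-≤ f []       []           = z≤n
  length-concatMap-≤ f (x ∷ xs) (fx≤m ∷ f≤m) =
    ≤-trans (≤-reflexive (length-++ (f x))) (+-mono-≤ fx≤m (length-concatMap-≤ f xs f≤m))

module _ {a b r} {A : Set a} {B : Set b} {R : REL A B r} (R? : Decidable₂ R) where

  double-counting : ∀ xs ys →
    sum (map (λ x → length (filter (R? x) ys)) xs) ≡ sum (map (λ y → length (filter (λ x → R? x y) xs)) ys)
  double-counting []       ys = sym (sum-map-0 ys)
  double-counting (x ∷ xs) ys = begin
    length (filter (R? x) ys) + sum (map (λ x → length (filter (R? x) ys)) xs)
      ≡⟨ cong₂ _+_ (sym (sum-map-if-does (R? x) ys)) (double-counting xs ys) ⟩
    sum (map (λ y → if does (R? x y) then 1 else 0) ys) + sum (map (λ y → length (filter (λ x → R? x y) xs)) ys)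
      ≡⟨ sum-map-+ _ _ ys ⟨
    sum (map (λ y → (if does (R? x y) then 1 else 0) + length (filter (λ x → R? x y) xs)) ys)
      ≡⟨ sum-map-cong ys (λ y → length-filter-∷ (λ x → R? x y) x xs) ⟨
    sum (map (λ y → length (filter (λ x → R? x y) (x ∷ xs))) ys) ∎
    where open ≡-Reasoning

  double-counting-≤ : ∀ {d e m} xs ys →
    All (λ y → d ≤ length (filter (λ x → R? x y) xs)) ys →
    All (λ x → e * length (filter (R? x) ys) ≤ m) xs →
    e * (length ys * d) ≤ length xs * m
  double-counting-≤ {d} {e} {m} xs ys d≤deg e*deg≤m = begin
    e * (length ys * d)                                        ≤⟨ *-monoʳ-≤ e (sum-map-≥ d≤deg) ⟩
    e * sum (map (λ y → length (filter (λ x → R? x y) xs)) ys) ≡⟨ cong (e *_) (double-counting xs ys) ⟨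
    e * sum (map (λ x → length (filter (R? x) ys)) xs)         ≡⟨ *-sum-map e _ xs ⟩
    sum (map (λ x → e * length (filter (R? x) ys)) xs)         ≤⟨ sum-map-≤ e*deg≤m ⟩
    length xs * m                                              ∎
    where open ≤-Reasoning

  length-≤-cover : ∀ {m} xs ys → All (λ y → Any (λ x → R x y) xs) ys →
                   All (λ x → length (filter (R? x) ys) ≤ m) xs → length ys ≤ length xs * m
  length-≤-cover {m} xs ys covered deg≤m = begin
    length ys           ≡⟨ trans (*-identityˡ (length ys * 1)) (*-identityʳ (length ys)) ⟨
    1 * (length ys * 1) ≤⟨ double-counting-≤ {1} {1} xs ys (All.map (filter-some (λ x → R? x _)) covered)
                                               (All.map (≤-trans (≤-reflexive (*-identityˡ _))) deg≤m) ⟩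
    length xs * m       ∎
    where open ≤-Reasoning

module _ {a} {A : Set a} (_≟_ : DecidableEquality A) where

  open import Data.List.Membership.DecPropositional _≟_ using (_∈?_; _∉?_)

  removeAll : A → List A → List A
  removeAll x = filter (λ y → ¬? (x ≟ y))

  ∈-removeAll⁺ : ∀ {x y xs} → y ∈ xs → x ≢ y → y ∈ removeAll x xs
  ∈-removeAll⁺ {x} = ∈-filter⁺ (λ y → ¬? (x ≟ y))

  ∈-removeAll⁻ : ∀ {x y xs} → y ∈ removeAll x xs → y ∈ xs
  ∈-removeAll⁻ {x} y∈ with ∈-filter⁻ (λ y → ¬? (x ≟ y)) y∈
  ... | y∈xs , _ = y∈xs

  ⊆-∷-removeAll : ∀ {x xs} → xs ⊆ x ∷ removeAll x xs
  ⊆-∷-removeAll {x} {_} {y} y∈xs with x ≟ y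
  ... | yes refl = here refl
  ... | no x≢y   = there (∈-removeAll⁺ y∈xs x≢y)

  length-removeAll-< : ∀ {x xs} → x ∈ xs → length (removeAll x xs) < length xs
  length-removeAll-< {x} x∈xs =
    filter-notAll (λ y → ¬? (x ≟ y)) _ (Any.map (λ x≡y x≢y → x≢y x≡y) x∈xs)

  Unique-⊆⇒length-≤ : ∀ {xs ys} → Unique xs → xs ⊆ ys → length xs ≤ length ys
  Unique-⊆⇒length-≤ []                  _     = z≤n
  Unique-⊆⇒length-≤ {x ∷ xs} {ys} (x∉xs ∷ u) xs⊆ys =
    ≤-trans (s≤s (Unique-⊆⇒length-≤ u xs⊆ys∖x)) (length-removeAll-< (xs⊆ys (here refl)))
    where
    xs⊆ys∖x : xs ⊆ removeAll x ys
    xs⊆ys∖x y∈xs = ∈-removeAll⁺ (xs⊆ys (there y∈xs)) (All.lookup x∉xs y∈xs)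

  length-removeAll : ∀ {x xs} → Unique xs → x ∈ xs → suc (length (removeAll x xs)) ≡ length xs
  length-removeAll {x} u x∈xs =
    ≤-antisym (length-removeAll-< x∈xs) (Unique-⊆⇒length-≤ u (⊆-∷-removeAll {x}))

  removeAll-⊆⁻ : ∀ {x xs ys} → x ∈ ys → removeAll x xs ⊆ removeAll x ys → xs ⊆ ys
  removeAll-⊆⁻ {x} x∈ys sub y∈xs with ⊆-∷-removeAll {x} y∈xs
  ... | here refl = x∈ys
  ... | there y∈  = ∈-removeAll⁻ (sub y∈)

  window : ℕ → List A → List A → List A
  window w T R = take w (filter (_∉? T) R)

  window-meets : ∀ {t C R T} → Unique C → C ⊆ R → t ≤ length C → t ≤ length R →
               length (filter (_∈? T) R) < t → Any (_∈ C) (window (length R ∸ t + 1) T R)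
  window-meets {t} {C} {R} {T} uC C⊆R t≤∣C∣ t≤∣R∣ ∣E∣<t with any? (_∈? C) (window (length R ∸ t + 1) T R)
  ... | yes meets = meets
  ... | no ¬meets = contradiction (≤-trans t≤∣C∣ (Unique-⊆⇒length-≤ uC C⊆E++rest)) (<⇒≱ bound)
    where
    E = filter (_∈? T) R
    D = filter (_∉? T) R
    w = length R ∸ t + 1
    C⊆E++rest : C ⊆ E ++ drop w D
    C⊆E++rest {x} x∈C with x ∈? T
    ... | yes x∈T = ∈-++⁺ˡ (∈-filter⁺ (_∈? T) (C⊆R x∈C) x∈T)
    ... | no  x∉T with ∈-++⁻ (take w D) (subst (x ∈_) (sym (take++drop≡id w D)) (∈-filter⁺ (_∉? T) (C⊆R x∈C) x∉T))
    ...   | inj₁ x∈W    = contradiction (lose x∈W x∈C) ¬meets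
    ...   | inj₂ x∈rest = ∈-++⁺ʳ E x∈rest
    ∣E∣+∣D∣≡∣R∣ : length E + length D ≡ length R
    ∣E∣+∣D∣≡∣R∣ = length-filter+length-filter-¬ (_∈? T) R
    bound : length (E ++ drop w D) < t
    bound = subst (_< t)
      (sym (trans (length-++ E) (cong (length E +_) (length-drop w D))))
      (subst (λ ℓ → length E + (length D ∸ (ℓ ∸ t + 1)) < t) ∣E∣+∣D∣≡∣R∣
        (a+[d∸[a+d∸t+1]]<t ∣E∣<t (subst (t ≤_) (sym ∣E∣+∣D∣≡∣R∣) t≤∣R∣)))

-- Subsets of Fin n

∣p─q∣+∣q∣≡∣p∣ : ∀ {n} {p q : Subset n} → q ⊆ₛ p → ∣ p ─ q ∣ + ∣ q ∣ ≡ ∣ p ∣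
∣p─q∣+∣q∣≡∣p∣ {p = []}          {[]}          _   = refl
∣p─q∣+∣q∣≡∣p∣ {p = inside ∷ p}  {outside ∷ q} q⊆p = cong suc (∣p─q∣+∣q∣≡∣p∣ (drop-∷-⊆ q⊆p))
∣p─q∣+∣q∣≡∣p∣ {p = outside ∷ p} {outside ∷ q} q⊆p = ∣p─q∣+∣q∣≡∣p∣ (drop-∷-⊆ q⊆p)
∣p─q∣+∣q∣≡∣p∣ {p = inside ∷ p}  {inside ∷ q}  q⊆p =
  trans (+-suc ∣ p ─ q ∣ ∣ q ∣) (cong suc (∣p─q∣+∣q∣≡∣p∣ (drop-∷-⊆ q⊆p)))
∣p─q∣+∣q∣≡∣p∣ {p = outside ∷ p} {inside ∷ q}  q⊆p with q⊆p here
... | ()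

∣p─q∣≡∣p∣∸∣q∣ : ∀ {n} {p q : Subset n} → q ⊆ₛ p → ∣ p ─ q ∣ ≡ ∣ p ∣ ∸ ∣ q ∣
∣p─q∣≡∣p∣∸∣q∣ {p = p} {q} q⊆p =
  trans (sym (m+n∸n≡m ∣ p ─ q ∣ ∣ q ∣)) (cong (_∸ ∣ q ∣) (∣p─q∣+∣q∣≡∣p∣ q⊆p))

r⊆p∧Empty[q∩r]⇒r⊆p─q : ∀ {n} {p q r : Subset n} → r ⊆ₛ p → Empty (q ∩ r) → r ⊆ₛ p ─ q
r⊆p∧Empty[q∩r]⇒r⊆p─q r⊆p q∩r≡∅ x∈r =
  x∈p∧x∉q⇒x∈p─q (r⊆p x∈r) (λ x∈q → q∩r≡∅ (_ , x∈p∩q⁺ (x∈q , x∈r)))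

kSubsets : ∀ {n} → ℕ → Subset n → List (Subset n)
kSubsets k       (outside ∷ p) = map (outside ∷_) (kSubsets k p)
kSubsets zero    (inside ∷ p)  = map (outside ∷_) (kSubsets zero p)
kSubsets (suc k) (inside ∷ p)  = map (inside ∷_) (kSubsets k p) ++ map (outside ∷_) (kSubsets (suc k) p)
kSubsets zero    []            = [ [] ]
kSubsets (suc k) []            = []

length-kSubsets : ∀ {n} k (p : Subset n) → length (kSubsets k p) ≡ ∣ p ∣ C k
length-kSubsets k       (outside ∷ p) = trans (length-map _ (kSubsets k p)) (length-kSubsets k p)
length-kSubsets zero    (inside ∷ p)  = trans (length-map _ (kSubsets zero p)) (length-kSubsets zero p)
length-kSubsets (suc k) (inside ∷ p)  = begin
  length (map (inside ∷_) (kSubsets k p) ++ map (outside ∷_) (kSubsets (suc k) p))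
    ≡⟨ length-++ (map (inside ∷_) (kSubsets k p)) ⟩
  length (map (inside ∷_) (kSubsets k p)) + length (map (outside ∷_) (kSubsets (suc k) p))
    ≡⟨ cong₂ _+_ (length-map _ (kSubsets k p)) (length-map _ (kSubsets (suc k) p)) ⟩
  length (kSubsets k p) + length (kSubsets (suc k) p)
    ≡⟨ cong₂ _+_ (length-kSubsets k p) (length-kSubsets (suc k) p) ⟩
  ∣ p ∣ C k + ∣ p ∣ C suc k
    ≡⟨ nCk+nC[k+1]≡[n+1]C[k+1] ∣ p ∣ k ⟩
  suc ∣ p ∣ C suc k ∎
  where open ≡-Reasoning
length-kSubsets zero    []            = refl
length-kSubsets (suc k) []            = sym (k>n⇒nCk≡0 {0} {suc k} (s≤s z≤n))

∈-kSubsets⁺ : ∀ {n} k {p q : Subset n} → ∣ q ∣ ≡ k → q ⊆ₛ p → q ∈ kSubsets k p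
∈-kSubsets⁺ zero    {[]}          {[]}          refl _   = here refl
∈-kSubsets⁺ k       {outside ∷ p} {outside ∷ q} ∣q∣≡k q⊆p =
  ∈-map⁺ (outside ∷_) (∈-kSubsets⁺ k ∣q∣≡k (drop-∷-⊆ q⊆p))
∈-kSubsets⁺ zero    {inside ∷ p}  {outside ∷ q} ∣q∣≡k q⊆p =
  ∈-map⁺ (outside ∷_) (∈-kSubsets⁺ zero ∣q∣≡k (drop-∷-⊆ q⊆p))
∈-kSubsets⁺ (suc k) {inside ∷ p}  {outside ∷ q} ∣q∣≡k q⊆p =
  ∈-++⁺ʳ (map (inside ∷_) (kSubsets k p)) (∈-map⁺ (outside ∷_) (∈-kSubsets⁺ (suc k) ∣q∣≡k (drop-∷-⊆ q⊆p)))
∈-kSubsets⁺ (suc k) {inside ∷ p}  {inside ∷ q}  refl  q⊆p =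
  ∈-++⁺ˡ (∈-map⁺ (inside ∷_) (∈-kSubsets⁺ k refl (drop-∷-⊆ q⊆p)))
∈-kSubsets⁺ k       {outside ∷ p} {inside ∷ q}  _     q⊆p with q⊆p here
... | ()

∈-kSubsets⁻ : ∀ {n} k (p : Subset n) {q} → q ∈ kSubsets k p → ∣ q ∣ ≡ k × q ⊆ₛ p
∈-kSubsets⁻ k       (outside ∷ p) q∈ with ∈-map⁻ (outside ∷_) q∈
... | r , r∈ , refl with ∈-kSubsets⁻ k p r∈
...   | ∣r∣≡k , r⊆p = ∣r∣≡k , out⊆ r⊆p
∈-kSubsets⁻ zero    (inside ∷ p)  q∈ with ∈-map⁻ (outside ∷_) q∈
... | r , r∈ , refl with ∈-kSubsets⁻ zero p r∈
...   | ∣r∣≡0 , r⊆p = ∣r∣≡0 , out⊆ r⊆p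
∈-kSubsets⁻ (suc k) (inside ∷ p)  q∈ with ∈-++⁻ (map (inside ∷_) (kSubsets k p)) q∈
... | inj₁ q∈′ with ∈-map⁻ (inside ∷_) q∈′
...   | r , r∈ , refl with ∈-kSubsets⁻ k p r∈
...     | ∣r∣≡k , r⊆p = cong suc ∣r∣≡k , in⊆in r⊆p
∈-kSubsets⁻ (suc k) (inside ∷ p)  q∈ | inj₂ q∈′ with ∈-map⁻ (outside ∷_) q∈′
...   | r , r∈ , refl with ∈-kSubsets⁻ (suc k) p r∈
...     | ∣r∣≡k , r⊆p = ∣r∣≡k , out⊆ r⊆p
∈-kSubsets⁻ zero    []            (here refl) = refl , ⊆⊤

-- Families of subpartitions

_≟ₛ_ : ∀ {n} → DecidableEquality (Subset n)
_≟ₛ_ = ≡-dec Bool._≟_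

module _ {n k : ℕ} where

  open import Data.List.Membership.DecPropositional (_≟ₛ_ {n}) using (_∈?_)

  private
    Class = Subset n
    Subpartition = List Class

  disjoint-sym : Symmetric (λ (A B : Class) → Empty (A ∩ B))
  disjoint-sym {A} {B} = subst Empty (∩-comm A B)

  IsSubpartition-removeAll : ∀ {j} {A : Class} {P} → A ∈ P → IsSubpartition n k (suc j) P →
                             IsSubpartition n k j (removeAll _≟ₛ_ A P)
  IsSubpartition-removeAll {A = A} A∈P sp = record
    { numClasses = suc-injective (trans (length-removeAll _≟ₛ_ distinct A∈P) numClasses)
    ; distinct   = Unique.filter⁺ (λ B → ¬? (A ≟ₛ B)) distinct
    ; classSize  = All.filter⁺ (λ B → ¬? (A ≟ₛ B)) classSize
    ; disjoint   = AllPairs.filter⁺ (λ B → ¬? (A ≟ₛ B)) disjoint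
    }
    where open IsSubpartition sp

  removeAll-⊆─ : ∀ {j} {S A : Class} {P} → A ∈ P → IsSubpartition n k j P → All (_⊆ₛ S) P →
                 All (_⊆ₛ S ─ A) (removeAll _≟ₛ_ A P)
  removeAll-⊆─ {A = A} A∈P sp P⊆S = All.tabulate λ B∈ →
    let (B∈P , A≢B) = ∈-filter⁻ (λ B → ¬? (A ≟ₛ B)) B∈ in
    r⊆p∧Empty[q∩r]⇒r⊆p─q (All.lookup P⊆S B∈P)
      (AllPairs-lookup disjoint-sym (IsSubpartition.disjoint sp) A∈P B∈P A≢B)

  ¬SameClasses-removeAll : ∀ {A : Class} {P Q} → A ∈ P → A ∈ Q → ¬ SameClasses P Q →
                           ¬ SameClasses (removeAll _≟ₛ_ A P) (removeAll _≟ₛ_ A Q)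
  ¬SameClasses-removeAll A∈P A∈Q P≉Q (P∖A⊆Q∖A , Q∖A⊆P∖A) =
    P≉Q (removeAll-⊆⁻ _≟ₛ_ A∈Q P∖A⊆Q∖A , removeAll-⊆⁻ _≟ₛ_ A∈P Q∖A⊆P∖A)

  IsFamilyIn : ℕ → Class → List Subpartition → Set
  IsFamilyIn j S G = IsFamily n k j G × All (All (_⊆ₛ S)) G

  IsFamilyIn-filter : ∀ {j S G} {p} {P : Pred Subpartition p} (P? : Decidable P) →
                      IsFamilyIn j S G → IsFamilyIn j S (filter P? G)
  IsFamilyIn-filter P? (fam , G⊆S) = record
    { members  = All.filter⁺ P? (IsFamily.members fam)
    ; distinct = AllPairs.filter⁺ P? (IsFamily.distinct fam)
    } , All.filter⁺ P? G⊆S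

  IsFamilyIn-removeAll : ∀ {j S A G} → All (A ∈_) G → IsFamilyIn (suc j) S G →
                         IsFamilyIn j (S ─ A) (map (removeAll _≟ₛ_ A) G)
  IsFamilyIn-removeAll {A = A} {G} A∈G (fam , G⊆S) = record
    { members  = All.map⁺ (All.tabulate λ P∈G → IsSubpartition-removeAll (A∈ P∈G) (member P∈G))
    ; distinct = AllPairs.map⁺ (AllPairs-discharge A∈G
        (AllPairs.map (λ P≉Q A∈P A∈Q → ¬SameClasses-removeAll A∈P A∈Q P≉Q) (IsFamily.distinct fam)))
    } , All.map⁺ (All.tabulate λ P∈G → removeAll-⊆─ (A∈ P∈G) (member P∈G) (All.lookup G⊆S P∈G))
    where
    member = All.lookup (IsFamily.members fam)
    A∈ = All.lookup A∈G

  classes⊆kSubsets : ∀ {j S P} → IsSubpartition n k j P → All (_⊆ₛ S) P → P ⊆ kSubsets k S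
  classes⊆kSubsets sp P⊆S A∈P =
    ∈-kSubsets⁺ k (All.lookup (IsSubpartition.classSize sp) A∈P) (All.lookup P⊆S A∈P)

  family-bound : ∀ j (S : Class) {G} → IsFamilyIn j S G → j ! * length G ≤ prodBinom ∣ S ∣ j k
  family-bound zero    S {[]}        _              = z≤n
  family-bound zero    S {_ ∷ []}    _              = ≤-refl
  family-bound zero    S {P ∷ Q ∷ _} (fam , _)
    with IsFamily.members fam | IsFamily.distinct fam
  ... | sp ∷ sq ∷ _ | (P≉Q ∷ _) ∷ _ = ⊥-elim (P≉Q (empty⊆ (numClasses sp) , empty⊆ (numClasses sq)))
    where
    open IsSubpartition
    empty⊆ : ∀ {P R : Subpartition} → length P ≡ 0 → P ⊆ R
    empty⊆ {[]} _ ()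
  family-bound (suc j) S {G} famS@(fam , G⊆S) = begin
    suc j ! * length G                  ≡⟨ reorder (suc j) (j !) (length G) ⟩
    j ! * (length G * suc j)            ≤⟨ double-counting-≤ _∈?_ {e = j !} K G
                                             classes-in-K bound-per-class ⟩
    length K * prodBinom (∣ S ∣ ∸ k) j k ≡⟨ cong (_* prodBinom (∣ S ∣ ∸ k) j k) (length-kSubsets k S) ⟩
    prodBinom ∣ S ∣ (suc j) k           ∎
    where
    open ≤-Reasoning
    K = kSubsets k S
    reorder : ∀ a b c → a * b * c ≡ b * (c * a)
    reorder a b c = trans (cong (_* c) (*-comm a b)) (trans (*-assoc b a c) (cong (b *_) (*-comm a c)))
    classes-in-K : All (λ P → suc j ≤ length (filter (_∈? P) K)) G
    classes-in-K = All.tabulate λ {P} P∈G →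
      let sp = All.lookup (IsFamily.members fam) P∈G
          P⊆K = classes⊆kSubsets sp (All.lookup G⊆S P∈G)
      in subst (_≤ length (filter (_∈? P) K)) (IsSubpartition.numClasses sp)
           (Unique-⊆⇒length-≤ _≟ₛ_ (IsSubpartition.distinct sp) λ A∈P → ∈-filter⁺ (_∈? P) (P⊆K A∈P) A∈P)
    bound-per-class : All (λ A → j ! * length (filter (A ∈?_) G) ≤ prodBinom (∣ S ∣ ∸ k) j k) K
    bound-per-class = All.tabulate λ {A} A∈K →
      let (∣A∣≡k , A⊆S) = ∈-kSubsets⁻ k S A∈K
          G∋A = filter (A ∈?_) G
      in subst₂ _≤_ (cong (j ! *_) (length-map _ G∋A))
           (cong (λ m → prodBinom m j k) (trans (∣p─q∣≡∣p∣∸∣q∣ A⊆S) (cong (∣ S ∣ ∸_) ∣A∣≡k)))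
           (family-bound j (S ─ A)
             (IsFamilyIn-removeAll (All.all-filter (A ∈?_) G) (IsFamilyIn-filter (A ∈?_) famS)))

  fixed-classes-bound : ∀ Cs j (S : Class) {G} → Unique Cs → IsFamilyIn j S G →
    All (λ P → All (_∈ P) Cs) G →
    (j ∸ length Cs) ! * length G ≤ prodBinom (∣ S ∣ ∸ length Cs * k) (j ∸ length Cs) k
  fixed-classes-bound []       j       S           _ famS _ = family-bound j S famS
  fixed-classes-bound (A ∷ Cs) zero    S           _ famS _ = family-bound zero S famS
  fixed-classes-bound (A ∷ Cs) (suc j) S {[]}      _ _    _ =
    ≤-trans (≤-reflexive (*-zeroʳ ((j ∸ length Cs) !))) z≤n
  fixed-classes-bound (A ∷ Cs) (suc j) S {G@(P ∷ _)} (A∉Cs ∷ uCs) famS@(fam , G⊆S) Cs⊆G@((A∈P ∷ _) ∷ _) =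
    subst₂ _≤_ (cong ((j ∸ length Cs) ! *_) (length-map _ G))
      (cong (λ m → prodBinom m (j ∸ length Cs) k) ∣S─A∣∸∣Cs∣k)
      (fixed-classes-bound Cs j (S ─ A) uCs (IsFamilyIn-removeAll A∈G famS)
        (All.map⁺ (All.map (λ Cs⊆Q → All.zipWith (λ (A≢C , C∈Q) → ∈-removeAll⁺ _≟ₛ_ C∈Q A≢C)
                                       (A∉Cs , All.tail Cs⊆Q)) Cs⊆G)))
    where
    A∈G : All (A ∈_) G
    A∈G = All.map All.head Cs⊆G
    ∣A∣≡k : ∣ A ∣ ≡ k
    ∣A∣≡k = All.lookup (IsSubpartition.classSize (All.head (IsFamily.members fam))) A∈P
    ∣S─A∣∸∣Cs∣k : ∣ S ─ A ∣ ∸ length Cs * k ≡ ∣ S ∣ ∸ (k + length Cs * k)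
    ∣S─A∣∸∣Cs∣k = begin
      ∣ S ─ A ∣ ∸ length Cs * k     ≡⟨ cong (_∸ length Cs * k) (∣p─q∣≡∣p∣∸∣q∣ (All.lookup (All.head G⊆S) A∈P)) ⟩
      ∣ S ∣ ∸ ∣ A ∣ ∸ length Cs * k ≡⟨ cong (λ a → ∣ S ∣ ∸ a ∸ length Cs * k) ∣A∣≡k ⟩
      ∣ S ∣ ∸ k ∸ length Cs * k     ≡⟨ ∸-+-assoc ∣ S ∣ k (length Cs * k) ⟩
      ∣ S ∣ ∸ (k + length Cs * k)   ∎
      where open ≡-Reasoning

-- Covering a t-intersecting family

module _ {n k ℓ t : ℕ} {F : List (List (Subset n))} (1≤t : 1 ≤ t) (t<ℓ : t < ℓ)
         (fam : IsFamily n k ℓ F) (F-int : IsTIntersectingFamily t F)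
         (no-common-class : ¬ (Σ (Subset n) λ A → ∣ A ∣ ≡ k × All (A ∈_) F)) where

  open import Data.List.Membership.DecPropositional (_≟ₛ_ {n}) using (_∈?_)

  private
    Class = Subset n
    Subpartition = List Class

    w : ℕ
    w = ℓ ∸ t + 1

    member : ∀ {P} → P ∈ F → IsSubpartition n k ℓ P
    member = All.lookup (IsFamily.members fam)

    common : ∀ {P Q} → P ∈ F → Q ∈ F → TIntersecting t P Q
    common P∈F Q∈F = All.lookup (All.lookup F-int P∈F) Q∈F

  avoider : Class → Subpartition
  avoider A = firstFailing (A ∈?_) [] F

  avoider-spec : ∀ {A} → ∣ A ∣ ≡ k → avoider A ∈ F × A ∉ avoider A
  avoider-spec {A} ∣A∣≡k = firstFailing-spec (A ∈?_) F (λ A∈F → no-common-class (A , ∣A∣≡k , A∈F))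

  extensions : Subpartition → List Subpartition
  extensions []      = []
  extensions (A ∷ T) = map (_∷ A ∷ T) (window _≟ₛ_ w (A ∷ T) (avoider A))

  candidates : Subpartition → List Subpartition
  candidates P = concatMap extensions (combinations t P)

  length-candidates : ∀ {P} → P ∈ F → length (candidates P) ≤ (ℓ C t) * w
  length-candidates {P} P∈F = begin
    length (candidates P)         ≤⟨ length-concatMap-≤ extensions (combinations t P)
                                       (All.tabulate λ {T} _ → length-extensions T) ⟩
    length (combinations t P) * w ≡⟨ cong (_* w) (length-combinations t P) ⟩
    (length P C t) * w            ≡⟨ cong (λ m → (m C t) * w) (IsSubpartition.numClasses (member P∈F)) ⟩
    (ℓ C t) * w                   ∎
    where
    open ≤-Reasoning
    length-extensions : ∀ T → length (extensions T) ≤ w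
    length-extensions []      = z≤n
    length-extensions (A ∷ T) = begin
      length (extensions (A ∷ T))                ≡⟨ length-map _ (window _≟ₛ_ w (A ∷ T) (avoider A)) ⟩
      length (window _≟ₛ_ w (A ∷ T) (avoider A)) ≡⟨ length-take w _ ⟩
      w ⊓ _                                      ≤⟨ m⊓n≤m w _ ⟩
      w                                          ∎

  candidates-unique : ∀ {P} → P ∈ F → All (λ Cs → Unique Cs × length Cs ≡ suc t) (candidates P)
  candidates-unique {P} P∈F = All.concat⁺ (All.map⁺ (All.tabulate λ {T} T∈ →
    let (T⊑P , lenT) = ∈-combinations⁻ t P T∈ in
    extensions-unique (Unique-⊑ T⊑P (IsSubpartition.distinct (member P∈F))) lenT))
    where
    extensions-unique : ∀ {T} → Unique T → length T ≡ t →
                        All (λ Cs → Unique Cs × length Cs ≡ suc t) (extensions T)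
    extensions-unique {[]}    _  _    = []
    extensions-unique {A ∷ T} uT lenT =
      All.map⁺ (All.map (λ B∉T → (All.¬Any⇒All¬ _ B∉T ∷ uT) , cong suc lenT)
        (All.take⁺ w (All.all-filter (λ B → ¬? (B ∈? A ∷ T)) (avoider A))))

  window-meets-member : ∀ {A T Q R} → R ∈ F → A ∉ R → Q ∈ F → length (A ∷ T) ≡ t →
                 Any (_∈ Q) (window _≟ₛ_ w (A ∷ T) R)
  window-meets-member {A} {T} {Q} {R} R∈F A∉R Q∈F lenAT with common R∈F Q∈F
  ... | C , uC , lenC , C⊆R , C⊆Q = Any.map C⊆Q
        (subst (λ m → Any (_∈ C) (window _≟ₛ_ (m ∸ t + 1) (A ∷ T) R)) numClasses
          (window-meets _≟ₛ_ uC C⊆R (≤-reflexive (sym lenC)) (subst (t ≤_) (sym numClasses) (<⇒≤ t<ℓ)) ∣E∣<t))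
    where
    open IsSubpartition (member R∈F)
    E⊆T : filter (_∈? A ∷ T) R ⊆ T
    E⊆T x∈E with ∈-filter⁻ (_∈? A ∷ T) {xs = R} x∈E
    ... | x∈R , here refl = contradiction x∈R A∉R
    ... | _   , there x∈T = x∈T
    ∣E∣<t : length (filter (_∈? A ∷ T) R) < t
    ∣E∣<t = subst (length (filter (_∈? A ∷ T) R) <_) lenAT
      (s≤s (Unique-⊆⇒length-≤ _≟ₛ_ (Unique.filter⁺ (_∈? A ∷ T) distinct) E⊆T))

  extensions-cover : ∀ {T Q} → Q ∈ F → length T ≡ t → All (λ A → ∣ A ∣ ≡ k) T → All (_∈ Q) T →
                     Any (λ Cs → All (_∈ Q) Cs) (extensions T)
  extensions-cover {[]}    _   lenT _ _ = contradiction (subst (1 ≤_) (sym lenT) 1≤t) λ ()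
  extensions-cover {A ∷ T} Q∈F lenT (∣A∣≡k ∷ _) T⊆Q =
    let (R∈F , A∉R)     = avoider-spec ∣A∣≡k
        (B , B∈W , B∈Q) = find (window-meets-member R∈F A∉R Q∈F lenT)
    in lose (∈-map⁺ (_∷ A ∷ T) B∈W) (B∈Q ∷ T⊆Q)

  t≤∣shared∣ : ∀ {P Q} → P ∈ F → Q ∈ F → t ≤ length (filter (_∈? Q) P)
  t≤∣shared∣ {P} {Q} P∈F Q∈F with common P∈F Q∈F
  ... | C , uC , lenC , C⊆P , C⊆Q = subst (_≤ length (filter (_∈? Q) P)) lenC
        (Unique-⊆⇒length-≤ _≟ₛ_ uC λ x∈C → ∈-filter⁺ (_∈? Q) (C⊆P x∈C) (C⊆Q x∈C))

  candidates-cover : ∀ {P Q} → P ∈ F → Q ∈ F → Any (λ Cs → All (_∈ Q) Cs) (candidates P)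
  candidates-cover {P} {Q} P∈F Q∈F = Any.concat⁺ (Any.map⁺ (lose T∈ (extensions-cover Q∈F lenT
    (All.take⁺ t (All.filter⁺ (_∈? Q) (IsSubpartition.classSize (member P∈F))))
    (All.take⁺ t (All.all-filter (_∈? Q) P)))))
    where
    T = take t (filter (_∈? Q) P)
    lenT : length T ≡ t
    lenT = trans (length-take t _) (m≤n⇒m⊓n≡m (t≤∣shared∣ P∈F Q∈F))
    T∈ : T ∈ combinations t P
    T∈ = subst (λ m → T ∈ combinations m P) lenT
      (∈-combinations⁺ (⊆-trans (take-⊆ t _) (filter-⊆ (_∈? Q) P)))

  candidate-bound : ∀ {Cs} → Unique Cs × length Cs ≡ suc t →
                    length (filter (λ Q → all? (_∈? Q) Cs) F) ≤ U (n ∸ suc t * k) (ℓ ∸ suc t) k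
  candidate-bound {Cs} (uCs , lenCs) = m*n≤o⇒n≤o/m ((ℓ ∸ suc t) !) _ _ {{(ℓ ∸ suc t) !≢0}}
    (subst₂ (λ c m → (ℓ ∸ c) ! * length G ≤ prodBinom (m ∸ c * k) (ℓ ∸ c) k) lenCs (∣⊤∣≡n n)
      (fixed-classes-bound Cs ℓ ⊤ uCs
        (IsFamilyIn-filter (λ Q → all? (_∈? Q) Cs) (fam , All.tabulate λ _ → All.tabulate λ _ → ⊆⊤))
        (All.all-filter (λ Q → all? (_∈? Q) Cs) F)))
    where
    G = filter (λ Q → all? (_∈? Q) Cs) F

  t-intersecting-family-bound : ∀ {P} → P ∈ F →
    length F ≤ (ℓ ∸ t + 1) * (ℓ C t) * U (n ∸ (t + 1) * k) (ℓ ∸ (t + 1)) k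
  t-intersecting-family-bound {P} P∈F = begin
    length F                        ≤⟨ length-≤-cover (λ Cs Q → all? (_∈? Q) Cs) (candidates P) F
                                         (All.tabulate (candidates-cover P∈F))
                                         (All.map candidate-bound (candidates-unique P∈F)) ⟩
    length (candidates P) * U′ (suc t) ≤⟨ *-monoˡ-≤ (U′ (suc t)) (length-candidates P∈F) ⟩
    (ℓ C t) * w * U′ (suc t)          ≡⟨ cong (_* U′ (suc t)) (*-comm (ℓ C t) w) ⟩
    w * (ℓ C t) * U′ (suc t)          ≡⟨ cong (λ s → w * (ℓ C t) * U′ s) (+-comm 1 t) ⟩
    w * (ℓ C t) * U′ (t + 1)          ∎
    where
    open ≤-Reasoning
    U′ : ℕ → ℕ
    U′ s = U (n ∸ s * k) (ℓ ∸ s) k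

lemma3 : (n k ℓ t : ℕ) → 1 ≤ n → 1 ≤ k → 1 ≤ ℓ → 1 ≤ t → t ≤ ℓ ∸ 1 →
    (F : List (List (Subset n))) →
    IsFamily n k ℓ F →
    IsTIntersectingFamily t F →
    ¬ (Σ (Subset n) λ A → ∣ A ∣ ≡ k × All (λ P → A ∈ P) F) →
    length F ≤ (ℓ ∸ t + 1) * (ℓ C t) * U (n ∸ (t + 1) * k) (ℓ ∸ (t + 1)) k
lemma3 n k ℓ       t _ _ _         _   _   []      _   _     _         = z≤n
lemma3 n k (suc ℓ) t _ _ (s≤s z≤n) 1≤t t≤ℓ (P ∷ F) fam F-int no-common =
  t-intersecting-family-bound 1≤t (s≤s t≤ℓ) fam F-int no-common (here refl)
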